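{- The emptiness problem for multicounter automata (deciding whether a given MCA has an accepting run) is computably many-one reducible to the finite satisfiability problem for $\mathrm{C}^2(*,1,\{<,{+1}\})$; i.e. the latter problem is at least as hard as the former.
   Context: A multicounter automaton (MCA) is a tuple $\langle Q,C,R,\delta,q_I,F\rangle$ with finite state set $Q$, initial state $q_I$, final states $F\subseteq Q$, finite set of counters $C$, $R\subseteq C$, and $\delta\subseteq Q\times\{inc(c),dec(c),skip: c\in C\}\times Q$. Configurations are pairs $\langle p,\vec n\rangle$, $\vec n\in\mathbb{N}^C$; $inc(c)$ increments counter $c$, $dec(c)$ is applicable only when counter $c$ is positive and decrements it, skip changes no counter; the state changes from $p$ to $q$. An accepting run starts at $\langle q_I,\vec 0\rangle$ and ends in $\langle q_F,\vec n_F\rangle$ with $q_F\in F$ and $\vec n_F(c)=0$ for $c\in R$. $\mathrm{C}^2$ is the two-variable fragment of first-order logic with counting quantifiers $\exists^{<k},\exists^{\le k},\exists^{=k},\exists^{\ge k},\exists^{>k}$. $\mathrm{C}^2(*,1,\{<,{+1}\})$ denotes $\mathrm{C}^2$ sentences with arbitrarily many unary predicates, one additional binary predicate, and distinguished binary symbols $<$ (interpreted as a strict linear order) and ${+1}$ (its induced successor relation); finite satisfiability asks for a finite model. -}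

module Defs where

open import Data.Nat using (ℕ; zero; suc; _+_; _<ᵇ_; _≤ᵇ_; _≡ᵇ_)
open import Data.Bool using (Bool; true; false; _∧_; _∨_; not; if_then_else_)
open import Data.Fin using (Fin; _≟_; toℕ)
open import Relation.Nullary using (yes; no)
import Data.Fin as Fin
open import Data.Product using (Σ; ∃; _×_; _,_)
open import Data.List using (List)
open import Data.List.Membership.Propositional using (_∈_)
open import Relation.Binary.PropositionalEquality using (_≡_)
open import Relation.Binary.Structures using (IsStrictTotalOrder)
open import Relation.Binary.Construct.Closure.ReflexiveTransitive using (Star)

data Op (k : ℕ) : Set where
  inc  : Fin k → Op k
  dec  : Fin k → Op k
  skip : Op k

-- MCA ⟨Q, C, R, δ, q_I, F⟩ with Q = Fin nQ, C = Fin nC,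
-- R and F given as Boolean characteristic functions, δ a finite list.
record MCA : Set where
  field
    nQ    : ℕ
    nC    : ℕ
    R     : Fin nC → Bool
    δ     : List (Fin nQ × Op nC × Fin nQ)
    qI    : Fin nQ
    final : Fin nQ → Bool

module _ (A : MCA) where
  open MCA A

  Config : Set
  Config = Fin nQ × (Fin nC → ℕ)

  update : (Fin nC → ℕ) → Fin nC → ℕ → (Fin nC → ℕ)
  update v c m d with c ≟ d
  ... | yes _ = m
  ... | no  _ = v d

  data Step : Config → Config → Set where
    step-inc  : ∀ {p q c v} → (p , inc c , q) ∈ δ →
                Step (p , v) (q , update v c (suc (v c)))
    step-dec  : ∀ {p q c v m} → (p , dec c , q) ∈ δ → v c ≡ suc m →
                Step (p , v) (q , update v c m)
    step-skip : ∀ {p q v} → (p , skip , q) ∈ δ →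
                Step (p , v) (q , v)

  HasAcceptingRun : Set
  HasAcceptingRun =
    Σ (Fin nQ) λ qF → Σ (Fin nC → ℕ) λ nF →
      Star Step (qI , (λ _ → 0)) (qF , nF) ×
      final qF ≡ true ×
      (∀ c → R c ≡ true → nF c ≡ 0)

data Var : Set where
  vx vy : Var

data Cmp : Set where
  lt le eq ge gt : Cmp

-- formulas: arbitrarily many unary predicates P_i (i : ℕ),
-- one binary predicate B, equality, the order < and successor +1.
data Formula : Set where
  P     : ℕ → Var → Formula
  B     : Var → Var → Formula
  Eq    : Var → Var → Formula
  Less  : Var → Var → Formula
  Succ  : Var → Var → Formula
  ⊤f    : Formula
  ¬f    : Formula → Formula
  _∧f_  : Formula → Formula → Formula
  _∨f_  : Formula → Formula → Formula
  ∃f    : Var → Formula → Formula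
  ∀f    : Var → Formula → Formula
  ∃count : Cmp → ℕ → Var → Formula → Formula

setVar : (Var → Bool) → Var → (Var → Bool)
setVar b vx vx = true
setVar b vx vy = b vy
setVar b vy vx = b vx
setVar b vy vy = true

closedUnder : (Var → Bool) → Formula → Bool
closedUnder b (P i v)   = b v
closedUnder b (B v w)   = b v ∧ b w
closedUnder b (Eq v w)  = b v ∧ b w
closedUnder b (Less v w) = b v ∧ b w
closedUnder b (Succ v w) = b v ∧ b w
closedUnder b ⊤f        = true
closedUnder b (¬f φ)    = closedUnder b φ
closedUnder b (φ ∧f ψ)  = closedUnder b φ ∧ closedUnder b ψ
closedUnder b (φ ∨f ψ)  = closedUnder b φ ∧ closedUnder b ψ
closedUnder b (∃f v φ)  = closedUnder (setVar b v) φ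
closedUnder b (∀f v φ)  = closedUnder (setVar b v) φ
closedUnder b (∃count c k v φ) = closedUnder (setVar b v) φ

Sentence : Set
Sentence = Σ Formula λ φ → closedUnder (λ _ → false) φ ≡ true

count : (n : ℕ) → (Fin n → Bool) → ℕ
count zero    p = 0
count (suc n) p = (if p Fin.zero then 1 else 0) + count n (λ i → p (Fin.suc i))

-- finite structures with domain Fin n; < is any strict linear order,
-- +1 is its induced successor relation
record Structure (n : ℕ) : Set where
  field
    Pᴵ    : ℕ → Fin n → Bool
    Bᴵ    : Fin n → Fin n → Bool
    ltᴵ   : Fin n → Fin n → Bool
    ltᴵ-strictTotal : IsStrictTotalOrder _≡_ (λ a b → ltᴵ a b ≡ true)

module _ {n : ℕ} (𝔄 : Structure n) where
  open Structure 𝔄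

  succᴵ : Fin n → Fin n → Bool
  succᴵ a b = ltᴵ a b ∧ (count n (λ z → ltᴵ a z ∧ ltᴵ z b) ≡ᵇ 0)

  eqFin : Fin n → Fin n → Bool
  eqFin a b = toℕ a ≡ᵇ toℕ b

  assign : (Var → Fin n) → Var → Fin n → (Var → Fin n)
  assign ρ vx a vx = a
  assign ρ vx a vy = ρ vy
  assign ρ vy a vx = ρ vx
  assign ρ vy a vy = a

  cmp : Cmp → ℕ → ℕ → Bool
  cmp lt m k = m <ᵇ k
  cmp le m k = m ≤ᵇ k
  cmp eq m k = m ≡ᵇ k
  cmp ge m k = k ≤ᵇ m
  cmp gt m k = k <ᵇ m

  eval : Formula → (Var → Fin n) → Bool
  eval (P i v)    ρ = Pᴵ i (ρ v)
  eval (B v w)    ρ = Bᴵ (ρ v) (ρ w)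
  eval (Eq v w)   ρ = eqFin (ρ v) (ρ w)
  eval (Less v w) ρ = ltᴵ (ρ v) (ρ w)
  eval (Succ v w) ρ = succᴵ (ρ v) (ρ w)
  eval ⊤f         ρ = true
  eval (¬f φ)     ρ = not (eval φ ρ)
  eval (φ ∧f ψ)   ρ = eval φ ρ ∧ eval ψ ρ
  eval (φ ∨f ψ)   ρ = eval φ ρ ∨ eval ψ ρ
  eval (∃f v φ)   ρ = not (count n (λ a → eval φ (assign ρ v a)) ≡ᵇ 0)
  eval (∀f v φ)   ρ = count n (λ a → not (eval φ (assign ρ v a))) ≡ᵇ 0
  eval (∃count c k v φ) ρ = cmp c (count n (λ a → eval φ (assign ρ v a))) k

-- finite satisfiability of a sentence: a model with finite nonempty
-- domain Fin (suc m) (the assignment is irrelevant for sentences)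
FinSat : Sentence → Set
FinSat (φ , _) = Σ ℕ λ m → Σ (Structure (suc m)) λ 𝔄 →
  Σ (Var → Fin (suc m)) λ ρ → eval 𝔄 φ ρ ≡ true

module Submission where

open import Defs
open import Data.Bool using (Bool; true; false; T; not; _∧_; _∨_; if_then_else_)
open import Data.Bool.Properties using (T-≡; T-∧; T-∨; T?)
open import Data.Empty using (⊥-elim)
open import Data.Fin using (Fin; toℕ; _≟_; fromℕ<; inject₁) renaming (zero to fzero; suc to fsuc)
open import Data.Fin.Properties
  using (suc-injective; toℕ-injective; toℕ-fromℕ<; toℕ-inject₁; toℕ<n; toℕ≤pred[n]; any?)
  renaming (<-isStrictTotalOrder to Fin-<-isStrictTotalOrder)
open import Data.List using (List; []; _∷_; allFin)
open import Data.List.Membership.Propositional using (_∈_)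
open import Data.List.Membership.Propositional.Properties using (∈-allFin)
open import Data.List.Relation.Unary.Any using (here; there)
open import Data.Nat using (ℕ; zero; suc; _+_; _≤_; _<_; z≤n; s≤s; s≤s⁻¹; _≡ᵇ_; _≤ᵇ_; _<ᵇ_)
open import Data.Nat.Induction using (<-wellFounded)
open import Data.Nat.Properties
  using (+-comm; +-assoc; +-identityʳ; +-suc; ≤-refl; ≤-reflexive; ≤-trans; n≤0⇒n≡0; +-mono-≤; +-monoʳ-≤;
         +-mono-≤-<; <-cmp; <-irrefl; <-trans; <-≤-trans; ≮⇒≥; <⇒≱; n<1+n; _<?_;
         ≡ᵇ⇒≡; ≡⇒≡ᵇ; ≤ᵇ⇒≤; ≤⇒≤ᵇ; <ᵇ⇒<; <⇒<ᵇ)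
open import Data.Product using (Σ; ∃; ∃-syntax; _×_; _,_; proj₁; proj₂)
open import Data.Product.Function.NonDependent.Propositional using (_×-⇔_)
open import Data.Sum using (_⊎_; inj₁; inj₂)
open import Data.Sum.Function.Propositional using (_⊎-⇔_)
open import Data.Unit using (tt)
open import Function using (_∘_; _on_; case_of_; _⇔_; mk⇔; Equivalence)
open import Function.Construct.Identity using (⇔-id)
open import Function.Properties.Equivalence using () renaming (trans to ⇔-trans; sym to ⇔-sym)
open import Function.Related.TypeIsomorphisms using (→-cong-⇔; ¬-cong-⇔)
open import Induction.WellFounded using (Acc; acc)
import Relation.Binary.Construct.On as On
open import Relation.Binary.Construct.Closure.ReflexiveTransitive using (Star; ε; _◅_; _◅◅_)
open import Relation.Binary.Definitions using (Tri; tri<; tri≈; tri>)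
open import Relation.Binary.PropositionalEquality
  using (_≡_; _≢_; refl; sym; trans; cong; cong₂; subst; subst₂; module ≡-Reasoning)
open import Relation.Binary.Structures using (IsStrictTotalOrder)
open import Relation.Nullary using (¬_; Dec; yes; no)
open import Relation.Nullary.Decidable using (⌊_⌋; toWitness; fromWitness; _×-dec_; _⊎-dec_; ¬?)

open Equivalence using (to; from)

-- φ_A describes an accepting run laid out along the linear order: every element is a configuration,
-- labelled by its state and by the operation that entered it, successive elements are joined by a
-- transition, and the binary predicate matches each decrement of a counter with exactly one earlier
-- increment of that counter, each increment being matched at most once and, for counters in R, at
-- least once. An accepting run yields a model on its positions by matching the k-th increment of a
-- counter with its k-th decrement. Conversely, in a model the value of counter c at a position a is
-- the number of increments of c up to a whose matching decrement lies beyond a; induction along the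
-- order shows that each position is reached with these values, and at the last position the counters
-- in R are zero.

∀-⇔ : {A : Set} {P Q : A → Set} → (∀ a → P a ⇔ Q a) → (∀ a → P a) ⇔ (∀ a → Q a)
∀-⇔ P⇔Q = mk⇔ (λ f a → to (P⇔Q a) (f a)) (λ g a → from (P⇔Q a) (g a))

∃-⇔ : {A : Set} {P Q : A → Set} → (∀ a → P a ⇔ Q a) → ∃ P ⇔ ∃ Q
∃-⇔ P⇔Q = mk⇔ (λ (a , p) → a , to (P⇔Q a) p) (λ (a , q) → a , from (P⇔Q a) q)

⇔-cong : {A A′ B B′ : Set} → A ⇔ A′ → B ⇔ B′ → (A ⇔ B) ⇔ (A′ ⇔ B′)
⇔-cong A⇔A′ B⇔B′ = mk⇔ (λ A⇔B → ⇔-trans (⇔-sym A⇔A′) (⇔-trans A⇔B B⇔B′))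
                        (λ A′⇔B′ → ⇔-trans A⇔A′ (⇔-trans A′⇔B′ (⇔-sym B⇔B′)))

T-⌊⌋ : ∀ {P : Set} {P? : Dec P} → T ⌊ P? ⌋ ⇔ P
T-⌊⌋ = mk⇔ toWitness fromWitness

T-not : ∀ {b} → T (not b) ⇔ (¬ T b)
T-not {true}  = mk⇔ (λ ()) (λ ¬t → ⊥-elim (¬t tt))
T-not {false} = mk⇔ (λ _ ()) (λ _ → tt)

T-injective : ∀ {x y} → (T x ⇔ T y) → x ≡ y
T-injective {true}  {true}  _ = refl
T-injective {true}  {false} h = ⊥-elim (to h tt)
T-injective {false} {true}  h = ⊥-elim (from h tt)
T-injective {false} {false} _ = refl

⌊⌋-cong : ∀ {P Q : Set} {P? : Dec P} {Q? : Dec Q} → P ⇔ Q → ⌊ P? ⌋ ≡ ⌊ Q? ⌋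
⌊⌋-cong P⇔Q = T-injective (⇔-trans T-⌊⌋ (⇔-trans P⇔Q (⇔-sym T-⌊⌋)))

T-≡ᵇ : ∀ {m n} → T (m ≡ᵇ n) ⇔ m ≡ n
T-≡ᵇ {m} {n} = mk⇔ (≡ᵇ⇒≡ m n) (≡⇒≡ᵇ m n)

T-≤ᵇ : ∀ {m n} → T (m ≤ᵇ n) ⇔ m ≤ n
T-≤ᵇ {m} {n} = mk⇔ (≤ᵇ⇒≤ m n) ≤⇒≤ᵇ

T-<ᵇ : ∀ {m n} → T (m <ᵇ n) ⇔ m < n
T-<ᵇ {m} {n} = mk⇔ (<ᵇ⇒< m n) <⇒<ᵇ

+-exchange : ∀ a b c → a + (b + c) ≡ (b + a) + c
+-exchange a b c = trans (sym (+-assoc a b c)) (cong (_+ c) (+-comm a b))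

IsStrictTotalOrder-⇔ : ∀ {X : Set} {R S : X → X → Set} →
  IsStrictTotalOrder _≡_ R → (∀ {x y} → R x y ⇔ S x y) → IsStrictTotalOrder _≡_ S
IsStrictTotalOrder-⇔ {R = R} {S} sto R⇔S = record
  { isStrictPartialOrder = record
    { isEquivalence = isEquivalence
    ; irrefl        = λ x≡y → irrefl x≡y ∘ from R⇔S
    ; trans         = λ Sxy Syz → to R⇔S (R-trans (from R⇔S Sxy) (from R⇔S Syz))
    ; <-resp-≈      = (λ { refl Sxy → Sxy }) , (λ { refl Sxy → Sxy }) }
  ; compare = λ x y → tri-map (compare x y) }
  where
  open IsStrictTotalOrder sto using (isEquivalence; irrefl; compare) renaming (trans to R-trans)
  tri-map : ∀ {x y} → Tri (R x y) (x ≡ y) (R y x) → Tri (S x y) (x ≡ y) (S y x)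
  tri-map (tri< Rxy x≢y ¬Ryx) = tri< (to R⇔S Rxy) x≢y (¬Ryx ∘ from R⇔S)
  tri-map (tri≈ ¬Rxy x≡y ¬Ryx) = tri≈ (¬Rxy ∘ from R⇔S) x≡y (¬Ryx ∘ from R⇔S)
  tri-map (tri> ¬Rxy x≢y Ryx) = tri> (¬Rxy ∘ from R⇔S) x≢y (to R⇔S Ryx)

𝟙 : Bool → ℕ
𝟙 b = if b then 1 else 0

𝟙-true : ∀ {b} → T b → 𝟙 b ≡ 1
𝟙-true {true} _ = refl

𝟙-false : ∀ {b} → ¬ T b → 𝟙 b ≡ 0
𝟙-false {true}  ¬t = ⊥-elim (¬t tt)
𝟙-false {false} _  = refl

𝟙-mono : ∀ {x y} → (T x → T y) → 𝟙 x ≤ 𝟙 y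
𝟙-mono {true}  {true}  _ = ≤-refl
𝟙-mono {true}  {false} h = ⊥-elim (h tt)
𝟙-mono {false} _ = z≤n

count≡0⇒ : ∀ {n} {p : Fin n → Bool} → count n p ≡ 0 → ∀ a → ¬ T (p a)
count≡0⇒ {p = p} ≡0 fzero    with p fzero
... | false = λ ()
count≡0⇒ {p = p} ≡0 (fsuc a) with p fzero
... | false = count≡0⇒ ≡0 a

count≡0⇐ : ∀ {n} {p : Fin n → Bool} → (∀ a → ¬ T (p a)) → count n p ≡ 0
count≡0⇐ {zero}  _    = refl
count≡0⇐ {suc n} none = cong₂ _+_ (𝟙-false (none fzero)) (count≡0⇐ λ a → none (fsuc a))

count≡0 : ∀ {n} {p : Fin n → Bool} → count n p ≡ 0 ⇔ (∀ a → ¬ T (p a))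
count≡0 = mk⇔ count≡0⇒ count≡0⇐

count≢0 : ∀ {n} {p : Fin n → Bool} → count n p ≢ 0 ⇔ ∃ λ a → T (p a)
count≢0 {n} = mk⇔ (witness n) λ (a , pa) ≡0 → count≡0⇒ ≡0 a pa
  where
  witness : ∀ n {p : Fin n → Bool} → count n p ≢ 0 → ∃ λ a → T (p a)
  witness zero    ≢0 = ⊥-elim (≢0 refl)
  witness (suc n) {p} ≢0 with p fzero in e
  ... | true  = fzero , subst T (sym e) tt
  ... | false = let (a , pa) = witness n ≢0 in fsuc a , pa

AtMostOne : ∀ {n} → (Fin n → Bool) → Set
AtMostOne p = ∀ a b → T (p a) → T (p b) → a ≡ b

count≤1⇒ : ∀ {n} {p : Fin n → Bool} → count n p ≤ 1 → AtMostOne p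
count≤1⇒ {suc n} {p} ≤1 a b pa pb with p fzero in e
count≤1⇒ ≤1       fzero    fzero    _  _  | _     = refl
count≤1⇒ (s≤s ≤0) fzero    (fsuc b) _  pb | true  = ⊥-elim (count≡0⇒ (n≤0⇒n≡0 ≤0) b pb)
count≤1⇒ (s≤s ≤0) (fsuc a) _        pa _  | true  = ⊥-elim (count≡0⇒ (n≤0⇒n≡0 ≤0) a pa)
count≤1⇒ ≤1       fzero    (fsuc b) pa _  | false = ⊥-elim (subst T e pa)
count≤1⇒ ≤1       (fsuc a) fzero    _  pb | false = ⊥-elim (subst T e pb)
count≤1⇒ ≤1       (fsuc a) (fsuc b) pa pb | false = cong fsuc (count≤1⇒ ≤1 a b pa pb)

count≤1⇐ : ∀ {n} {p : Fin n → Bool} → AtMostOne p → count n p ≤ 1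
count≤1⇐ {zero}      _   = z≤n
count≤1⇐ {suc n} {p} amo with p fzero in e
... | true  = s≤s (≤-reflexive (count≡0⇐ λ a pa → fzero≢fsuc (amo fzero (fsuc a) (subst T (sym e) tt) pa)))
  where fzero≢fsuc : ∀ {a : Fin n} → fzero ≢ fsuc a
        fzero≢fsuc ()
... | false = count≤1⇐ λ a b pa pb → suc-injective (amo (fsuc a) (fsuc b) pa pb)

count≤1 : ∀ {n} {p : Fin n → Bool} → count n p ≤ 1 ⇔ AtMostOne p
count≤1 = mk⇔ count≤1⇒ count≤1⇐

ExactlyOne : ∀ {n} → (Fin n → Bool) → Set
ExactlyOne p = ∃ λ a → T (p a) × ∀ b → T (p b) → b ≡ a

count≡1 : ∀ {n} {p : Fin n → Bool} → count n p ≡ 1 ⇔ ExactlyOne p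
count≡1 = mk⇔
  (λ ≡1 → let (a , pa) = to count≢0 (λ ≡0 → 1≢0 (trans (sym ≡1) ≡0))
          in a , pa , λ b pb → count≤1⇒ (≤-reflexive ≡1) b a pb pa)
  (λ (a , pa , unique) → ≤1∧≢0⇒≡1 (count≤1⇐ λ b b′ pb pb′ → trans (unique b pb) (sym (unique b′ pb′)))
                                   (from count≢0 (a , pa)))
  where
  1≢0 : 1 ≢ 0
  1≢0 ()
  ≤1∧≢0⇒≡1 : ∀ {m} → m ≤ 1 → m ≢ 0 → m ≡ 1
  ≤1∧≢0⇒≡1 z≤n       ≢0 = ⊥-elim (≢0 refl)
  ≤1∧≢0⇒≡1 (s≤s z≤n) _  = refl

count-cong : ∀ {n} {p q : Fin n → Bool} → (∀ a → p a ≡ q a) → count n p ≡ count n q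
count-cong {zero}  _   = refl
count-cong {suc n} p≗q = cong₂ _+_ (cong 𝟙 (p≗q fzero)) (count-cong λ a → p≗q (fsuc a))

count-mono : ∀ {n} {p q : Fin n → Bool} → (∀ a → T (p a) → T (q a)) → count n p ≤ count n q
count-mono {zero}  _   = z≤n
count-mono {suc n} p⊆q = +-mono-≤ (𝟙-mono (p⊆q fzero)) (count-mono λ a → p⊆q (fsuc a))

count-mono-< : ∀ {n} {p q : Fin n → Bool} a → (∀ b → T (p b) → T (q b)) → ¬ T (p a) → T (q a) →
               count n p < count n q
count-mono-< fzero p⊆q ¬pa qa
  rewrite 𝟙-false ¬pa | 𝟙-true qa = s≤s (count-mono λ b → p⊆q (fsuc b))
count-mono-< (fsuc a) p⊆q ¬pa qa =
  +-mono-≤-< (𝟙-mono (p⊆q fzero)) (count-mono-< a (λ b → p⊆q (fsuc b)) ¬pa qa)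

count-agree-off : ∀ {n} {p q : Fin n → Bool} a → (∀ b → b ≢ a → p b ≡ q b) →
                  count n p + 𝟙 (q a) ≡ count n q + 𝟙 (p a)
count-agree-off {suc n} {p} {q} fzero agree =
  begin
    (𝟙 (p fzero) + count n (p ∘ fsuc)) + 𝟙 (q fzero) ≡⟨ +-comm _ (𝟙 (q fzero)) ⟩
    𝟙 (q fzero) + (𝟙 (p fzero) + count n (p ∘ fsuc)) ≡⟨ cong (𝟙 (q fzero) +_) (+-comm (𝟙 (p fzero)) _) ⟩
    𝟙 (q fzero) + (count n (p ∘ fsuc) + 𝟙 (p fzero)) ≡⟨ sym (+-assoc (𝟙 (q fzero)) _ _) ⟩
    (𝟙 (q fzero) + count n (p ∘ fsuc)) + 𝟙 (p fzero) ≡⟨ cong (λ m → (𝟙 (q fzero) + m) + 𝟙 (p fzero)) tails ⟩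
    (𝟙 (q fzero) + count n (q ∘ fsuc)) + 𝟙 (p fzero) ∎
  where
  open ≡-Reasoning
  tails : count n (p ∘ fsuc) ≡ count n (q ∘ fsuc)
  tails = count-cong λ b → agree (fsuc b) λ ()
count-agree-off {suc n} {p} {q} (fsuc a) agree =
  begin
    (𝟙 (p fzero) + count n (p ∘ fsuc)) + 𝟙 (q (fsuc a)) ≡⟨ +-assoc (𝟙 (p fzero)) _ _ ⟩
    𝟙 (p fzero) + (count n (p ∘ fsuc) + 𝟙 (q (fsuc a))) ≡⟨ cong₂ _+_ (cong 𝟙 heads) tails ⟩
    𝟙 (q fzero) + (count n (q ∘ fsuc) + 𝟙 (p (fsuc a))) ≡⟨ sym (+-assoc (𝟙 (q fzero)) _ _) ⟩
    (𝟙 (q fzero) + count n (q ∘ fsuc)) + 𝟙 (p (fsuc a)) ∎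
  where
  open ≡-Reasoning
  heads : p fzero ≡ q fzero
  heads = agree fzero λ ()
  tails : count n (p ∘ fsuc) + 𝟙 (q (fsuc a)) ≡ count n (q ∘ fsuc) + 𝟙 (p (fsuc a))
  tails = count-agree-off a λ b b≢a → agree (fsuc b) (b≢a ∘ suc-injective)

count-insert : ∀ {n} {p q : Fin n → Bool} a → T (p a) → ¬ T (q a) → (∀ b → b ≢ a → p b ≡ q b) →
               count n p ≡ suc (count n q)
count-insert {n} {p} {q} a pa ¬qa agree =
  begin
    count n p                 ≡⟨ sym (+-identityʳ _) ⟩
    count n p + 0             ≡⟨ cong (count n p +_) (sym (𝟙-false ¬qa)) ⟩
    count n p + 𝟙 (q a)       ≡⟨ count-agree-off a agree ⟩
    count n q + 𝟙 (p a)       ≡⟨ cong (count n q +_) (𝟙-true pa) ⟩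
    count n q + 1             ≡⟨ +-comm _ 1 ⟩
    suc (count n q)           ∎
  where open ≡-Reasoning

count-cong-off : ∀ {n} {p q : Fin n → Bool} a → ¬ T (p a) → ¬ T (q a) → (∀ b → b ≢ a → p b ≡ q b) →
                 count n p ≡ count n q
count-cong-off {n} {p} {q} a ¬pa ¬qa agree =
  begin
    count n p                 ≡⟨ sym (+-identityʳ _) ⟩
    count n p + 0             ≡⟨ cong (count n p +_) (sym (𝟙-false ¬qa)) ⟩
    count n p + 𝟙 (q a)       ≡⟨ count-agree-off a agree ⟩
    count n q + 𝟙 (p a)       ≡⟨ cong (count n q +_) (𝟙-false ¬pa) ⟩
    count n q + 0             ≡⟨ +-identityʳ _ ⟩
    count n q                 ∎
  where open ≡-Reasoning

-- Unfolds from the front: countBelow f (suc n) = 𝟙 (f 0) + countBelow (f ∘ suc) n.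
countBelow : (ℕ → Bool) → ℕ → ℕ
countBelow f n = count n (f ∘ toℕ)

countBelow-snoc : ∀ f n → countBelow f (suc n) ≡ countBelow f n + 𝟙 (f n)
countBelow-snoc f zero    = +-comm (𝟙 (f 0)) 0
countBelow-snoc f (suc n) =
  trans (cong (𝟙 (f 0) +_) (countBelow-snoc (f ∘ suc) n)) (sym (+-assoc (𝟙 (f 0)) _ _))

countBelow-mono : ∀ f {m n} → m ≤ n → countBelow f m ≤ countBelow f n
countBelow-mono f z≤n       = z≤n
countBelow-mono f (s≤s m≤n) = +-monoʳ-≤ (𝟙 (f 0)) (countBelow-mono (f ∘ suc) m≤n)

countBelow-suc-true : ∀ f {n} → T (f n) → countBelow f (suc n) ≡ suc (countBelow f n)
countBelow-suc-true f {n} fn =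
  trans (countBelow-snoc f n) (trans (cong (countBelow f n +_) (𝟙-true fn)) (+-comm _ 1))

countBelow-suc-false : ∀ f {n} → ¬ T (f n) → countBelow f (suc n) ≡ countBelow f n
countBelow-suc-false f {n} ¬fn =
  trans (countBelow-snoc f n) (trans (cong (countBelow f n +_) (𝟙-false ¬fn)) (+-identityʳ _))

countBelow-< : ∀ f {i j} → T (f i) → i < j → countBelow f i < countBelow f j
countBelow-< f fi i<j = ≤-trans (≤-reflexive (sym (countBelow-suc-true f fi))) (countBelow-mono f i<j)

countBelow-injective : ∀ f {i j} → T (f i) → T (f j) → countBelow f i ≡ countBelow f j → i ≡ j
countBelow-injective f {i} {j} fi fj same with <-cmp i j
... | tri< i<j _ _ = ⊥-elim (<-irrefl same (countBelow-< f fi i<j))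
... | tri≈ _ i≡j _ = i≡j
... | tri> _ _ j<i = ⊥-elim (<-irrefl (sym same) (countBelow-< f fj j<i))

countBelow-find : ∀ f {k} j → k < countBelow f j → ∃[ i ] i < j × T (f i) × countBelow f i ≡ k
countBelow-find f {k} (suc j) = split (f 0) refl k
  where
  split : ∀ b → f 0 ≡ b → ∀ k → k < 𝟙 b + countBelow (f ∘ suc) j →
          ∃[ i ] i < suc j × T (f i) × countBelow f i ≡ k
  split true  f0 zero    _        = 0 , s≤s z≤n , subst T (sym f0) tt , refl
  split true  f0 (suc k) (s≤s k<) =
    let (i , i<j , fi , ≡k) = countBelow-find (f ∘ suc) j k< in suc i , s≤s i<j , fi , cong₂ _+_ (cong 𝟙 f0) ≡k
  split false f0 k       k<       =
    let (i , i<j , fi , ≡k) = countBelow-find (f ∘ suc) j k< in suc i , s≤s i<j , fi , cong₂ _+_ (cong 𝟙 f0) ≡k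

⊥f : Formula
⊥f = ¬f ⊤f

bool : Bool → Formula
bool true  = ⊤f
bool false = ⊥f

infixr 4 _⇒f_ _⇔f_

_⇒f_ : Formula → Formula → Formula
φ ⇒f ψ = ¬f φ ∨f ψ

_⇔f_ : Formula → Formula → Formula
φ ⇔f ψ = (φ ⇒f ψ) ∧f (ψ ⇒f φ)

⋀ : {A : Set} → List A → (A → Formula) → Formula
⋀ []       f = ⊤f
⋀ (a ∷ as) f = f a ∧f ⋀ as f

⋁ : {A : Set} → List A → (A → Formula) → Formula
⋁ []       f = ⊥f
⋁ (a ∷ as) f = f a ∨f ⋁ as f

setVar-allBound : ∀ b → (∀ v → b v ≡ true) → ∀ w v → setVar b w v ≡ true
setVar-allBound b all vx vx = refl
setVar-allBound b all vx vy = all vy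
setVar-allBound b all vy vx = all vx
setVar-allBound b all vy vy = refl

closedUnder-allBound : ∀ b → (∀ v → b v ≡ true) → ∀ φ → closedUnder b φ ≡ true
closedUnder-allBound b all (P i v)    = all v
closedUnder-allBound b all (B v w)    rewrite all v | all w = refl
closedUnder-allBound b all (Eq v w)   rewrite all v | all w = refl
closedUnder-allBound b all (Less v w) rewrite all v | all w = refl
closedUnder-allBound b all (Succ v w) rewrite all v | all w = refl
closedUnder-allBound b all ⊤f         = refl
closedUnder-allBound b all (¬f φ)     = closedUnder-allBound b all φ
closedUnder-allBound b all (φ ∧f ψ)   rewrite closedUnder-allBound b all φ | closedUnder-allBound b all ψ = refl
closedUnder-allBound b all (φ ∨f ψ)   rewrite closedUnder-allBound b all φ | closedUnder-allBound b all ψ = refl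
closedUnder-allBound b all (∃f v φ)   = closedUnder-allBound _ (setVar-allBound b all v) φ
closedUnder-allBound b all (∀f v φ)   = closedUnder-allBound _ (setVar-allBound b all v) φ
closedUnder-allBound b all (∃count c k v φ) = closedUnder-allBound _ (setVar-allBound b all v) φ

∀∀ : Formula → Sentence
∀∀ φ = ∀f vx (∀f vy φ) , closedUnder-allBound _ bothBound φ
  where
  bothBound : ∀ v → setVar (setVar (λ _ → false) vx) vy v ≡ true
  bothBound vx = refl
  bothBound vy = refl

module Semantics {n : ℕ} (𝔄 : Structure n) where
  open Structure 𝔄

  -- A record rather than a synonym for `T (eval 𝔄 φ ρ)`, so that φ can be inferred from ⟦ φ ⟧ ρ.
  record ⟦_⟧_ (φ : Formula) (ρ : Var → Fin n) : Set where
    constructor holds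
    field true-in : T (eval 𝔄 φ ρ)
  open ⟦_⟧_

  _[_≔_] : (Var → Fin n) → Var → Fin n → (Var → Fin n)
  ρ [ v ≔ a ] = assign 𝔄 ρ v a

  private variable
    φ ψ : Formula
    ρ : Var → Fin n

  ⟦⟧-T : ⟦ φ ⟧ ρ ⇔ T (eval 𝔄 φ ρ)
  ⟦⟧-T = mk⇔ true-in holds

  T-⟦⟧ : T (eval 𝔄 φ ρ) ⇔ ⟦ φ ⟧ ρ
  T-⟦⟧ = mk⇔ holds true-in

  ⟦¬⟧ : ⟦ ¬f φ ⟧ ρ ⇔ (¬ ⟦ φ ⟧ ρ)
  ⟦¬⟧ = ⇔-trans ⟦⟧-T (⇔-trans T-not (¬-cong-⇔ T-⟦⟧))

  ⟦∧⟧ : ⟦ φ ∧f ψ ⟧ ρ ⇔ (⟦ φ ⟧ ρ × ⟦ ψ ⟧ ρ)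
  ⟦∧⟧ = ⇔-trans ⟦⟧-T (⇔-trans T-∧ (T-⟦⟧ ×-⇔ T-⟦⟧))

  ⟦∨⟧ : ⟦ φ ∨f ψ ⟧ ρ ⇔ (⟦ φ ⟧ ρ ⊎ ⟦ ψ ⟧ ρ)
  ⟦∨⟧ = ⇔-trans ⟦⟧-T (⇔-trans T-∨ (T-⟦⟧ ⊎-⇔ T-⟦⟧))

  ⟦⇒⟧ : ⟦ φ ⇒f ψ ⟧ ρ ⇔ (⟦ φ ⟧ ρ → ⟦ ψ ⟧ ρ)
  ⟦⇒⟧ {φ} {ψ} {ρ} = ⇔-trans ⟦⟧-T (⇔-trans (by-cases (eval 𝔄 φ ρ)) (→-cong-⇔ T-⟦⟧ T-⟦⟧))
    where
    by-cases : ∀ b → T (not b ∨ eval 𝔄 ψ ρ) ⇔ (T b → T (eval 𝔄 ψ ρ))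
    by-cases true  = mk⇔ (λ t _ → t) (λ f → f tt)
    by-cases false = mk⇔ (λ _ ()) (λ _ → tt)

  ⟦⇔⟧ : ⟦ φ ⇔f ψ ⟧ ρ ⇔ (⟦ φ ⟧ ρ ⇔ ⟦ ψ ⟧ ρ)
  ⟦⇔⟧ = ⇔-trans ⟦∧⟧ (⇔-trans (⟦⇒⟧ ×-⇔ ⟦⇒⟧) (mk⇔ (λ (f , g) → mk⇔ f g) (λ h → to h , from h)))

  ⟦bool⟧ : ∀ {b} → ⟦ bool b ⟧ ρ ⇔ T b
  ⟦bool⟧ {b = true}  = mk⇔ (λ _ → tt) (λ _ → holds tt)
  ⟦bool⟧ {b = false} = mk⇔ (λ ()) (λ ())

  ⟦∀⟧ : ∀ {v} → ⟦ ∀f v φ ⟧ ρ ⇔ (∀ a → ⟦ φ ⟧ (ρ [ v ≔ a ]))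
  ⟦∀⟧ = ⇔-trans ⟦⟧-T (⇔-trans T-≡ᵇ (⇔-trans count≡0 (∀-⇔ λ _ → ⇔-trans ¬T-not T-⟦⟧)))
    where
    ¬T-not : ∀ {b} → (¬ T (not b)) ⇔ T b
    ¬T-not {true}  = mk⇔ (λ _ → tt) (λ _ ())
    ¬T-not {false} = mk⇔ (λ ¬t → ⊥-elim (¬t tt)) (λ ())

  ⟦∃⟧ : ∀ {v} → ⟦ ∃f v φ ⟧ ρ ⇔ ∃ λ a → ⟦ φ ⟧ (ρ [ v ≔ a ])
  ⟦∃⟧ = ⇔-trans ⟦⟧-T (⇔-trans T-not (⇔-trans (¬-cong-⇔ T-≡ᵇ) (⇔-trans count≢0 (∃-⇔ λ _ → T-⟦⟧))))

  ⟦∃≤1⟧ : ∀ {v} → ⟦ ∃count le 1 v φ ⟧ ρ ⇔ (∀ a b → ⟦ φ ⟧ (ρ [ v ≔ a ]) → ⟦ φ ⟧ (ρ [ v ≔ b ]) → a ≡ b)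
  ⟦∃≤1⟧ = ⇔-trans ⟦⟧-T (⇔-trans T-≤ᵇ (⇔-trans count≤1
            (∀-⇔ λ _ → ∀-⇔ λ _ → →-cong-⇔ T-⟦⟧ (→-cong-⇔ T-⟦⟧ (⇔-id _)))))

  ⟦∃=1⟧ : ∀ {v} → ⟦ ∃count eq 1 v φ ⟧ ρ ⇔
          ∃ λ a → ⟦ φ ⟧ (ρ [ v ≔ a ]) × ∀ b → ⟦ φ ⟧ (ρ [ v ≔ b ]) → b ≡ a
  ⟦∃=1⟧ = ⇔-trans ⟦⟧-T (⇔-trans T-≡ᵇ (⇔-trans count≡1
            (∃-⇔ λ _ → T-⟦⟧ ×-⇔ ∀-⇔ λ _ → →-cong-⇔ T-⟦⟧ (⇔-id _))))

  ⟦⋀⟧ : ∀ {A : Set} (as : List A) {f : A → Formula} → ⟦ ⋀ as f ⟧ ρ ⇔ (∀ {a} → a ∈ as → ⟦ f a ⟧ ρ)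
  ⟦⋀⟧ []       = mk⇔ (λ _ ()) (λ _ → holds tt)
  ⟦⋀⟧ (a ∷ as) = ⇔-trans ⟦∧⟧ (mk⇔
    (λ (fa , fas) → λ { (here refl) → fa ; (there a∈) → to (⟦⋀⟧ as) fas a∈ })
    (λ h → h (here refl) , from (⟦⋀⟧ as) (λ a∈ → h (there a∈))))

  ⟦⋁⟧ : ∀ {A : Set} (as : List A) {f : A → Formula} → ⟦ ⋁ as f ⟧ ρ ⇔ ∃ λ a → a ∈ as × ⟦ f a ⟧ ρ
  ⟦⋁⟧ []       = mk⇔ (λ ()) (λ ())
  ⟦⋁⟧ (a ∷ as) = ⇔-trans ⟦∨⟧ (mk⇔
    (λ { (inj₁ fa) → a , here refl , fa
       ; (inj₂ fas) → let (b , b∈ , fb) = to (⟦⋁⟧ as) fas in b , there b∈ , fb })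
    (λ { (_ , here refl , fa) → inj₁ fa
       ; (b , there b∈ , fb) → inj₂ (from (⟦⋁⟧ as) (b , b∈ , fb)) }))

  ⟦⋀Fin⟧ : ∀ {k} {f : Fin k → Formula} → ⟦ ⋀ (allFin k) f ⟧ ρ ⇔ (∀ c → ⟦ f c ⟧ ρ)
  ⟦⋀Fin⟧ {k = k} = ⇔-trans (⟦⋀⟧ (allFin k)) (mk⇔ (λ h c → h (∈-allFin c)) (λ h {c} _ → h c))

  ⟦⋁Fin⟧ : ∀ {k} {f : Fin k → Formula} → ⟦ ⋁ (allFin k) f ⟧ ρ ⇔ ∃ λ c → ⟦ f c ⟧ ρ
  ⟦⋁Fin⟧ {k = k} = ⇔-trans (⟦⋁⟧ (allFin k)) (mk⇔ (λ (c , _ , fc) → c , fc) (λ (c , fc) → c , ∈-allFin c , fc))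

  T-succᴵ : ∀ {a b} → T (succᴵ 𝔄 a b) ⇔ (T (ltᴵ a b) × ∀ z → ¬ (T (ltᴵ a z) × T (ltᴵ z b)))
  T-succᴵ = ⇔-trans T-∧ (⇔-id _ ×-⇔ ⇔-trans T-≡ᵇ (⇔-trans count≡0 (∀-⇔ λ _ → ¬-cong-⇔ T-∧)))

data Unary : Set where
  state incs decs : ℕ → Unary

double : ℕ → ℕ
double zero    = zero
double (suc n) = suc (suc (double n))

-- Numbering of the unary predicates: state k ↦ 2k, incs k ↦ 4k + 1, decs k ↦ 4k + 3.
⌜_⌝ : Unary → ℕ
⌜ state k ⌝ = double k
⌜ incs k ⌝  = suc (double (double k))
⌜ decs k ⌝  = suc (suc (suc (double (double k))))

decode : ℕ → Unary
decode 0 = state 0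
decode 1 = incs 0
decode 2 = state 1
decode 3 = decs 0
decode (suc (suc (suc (suc i)))) = shift (decode i)
  where
  shift : Unary → Unary
  shift (state k) = state (suc (suc k))
  shift (incs k)  = incs (suc k)
  shift (decs k)  = decs (suc k)

decode-⌜⌝ : ∀ u → decode ⌜ u ⌝ ≡ u
decode-⌜⌝ (state zero)          = refl
decode-⌜⌝ (state (suc zero))    = refl
decode-⌜⌝ (state (suc (suc k))) rewrite decode-⌜⌝ (state k) = refl
decode-⌜⌝ (incs zero)           = refl
decode-⌜⌝ (incs (suc k))        rewrite decode-⌜⌝ (incs k) = refl
decode-⌜⌝ (decs zero)           = refl
decode-⌜⌝ (decs (suc k))        rewrite decode-⌜⌝ (decs k) = refl

incs? : ∀ {k} → Op k → ℕ → Bool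
incs? (inc c) m = toℕ c ≡ᵇ m
incs? (dec c) m = false
incs? skip    m = false

decs? : ∀ {k} → Op k → ℕ → Bool
decs? (inc c) m = false
decs? (dec c) m = toℕ c ≡ᵇ m
decs? skip    m = false

T-incs? : ∀ {k} {o : Op k} {c} → T (incs? o (toℕ c)) ⇔ o ≡ inc c
T-incs? {o = inc d} = mk⇔ (cong inc ∘ toℕ-injective ∘ to T-≡ᵇ) λ { refl → from (T-≡ᵇ {toℕ d}) refl }
T-incs? {o = dec d} = mk⇔ (λ ()) (λ ())
T-incs? {o = skip}  = mk⇔ (λ ()) (λ ())

T-decs? : ∀ {k} {o : Op k} {c} → T (decs? o (toℕ c)) ⇔ o ≡ dec c
T-decs? {o = inc d} = mk⇔ (λ ()) (λ ())
T-decs? {o = dec d} = mk⇔ (cong dec ∘ toℕ-injective ∘ to T-≡ᵇ) λ { refl → from (T-≡ᵇ {toℕ d}) refl }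
T-decs? {o = skip}  = mk⇔ (λ ()) (λ ())

module Reduction (A : MCA) where
  open MCA A

  Transition : Set
  Transition = Fin nQ × Op nC × Fin nQ

  source : Transition → Fin nQ
  source = proj₁

  label : Transition → Op nC
  label = proj₁ ∘ proj₂

  target : Transition → Fin nQ
  target = proj₂ ∘ proj₂

  StateP : Fin nQ → Var → Formula
  StateP q = P ⌜ state (toℕ q) ⌝

  IncP DecP : Fin nC → Var → Formula
  IncP c = P ⌜ incs (toℕ c) ⌝
  DecP c = P ⌜ decs (toℕ c) ⌝

  Carries : Op nC → Var → Formula
  Carries o v = ⋀ (allFin nC) λ c → (IncP c v ⇔f bool (incs? o (toℕ c))) ∧f (DecP c v ⇔f bool (decs? o (toℕ c)))

  Initial : Fin nQ → Formula
  Initial q = ¬f (∃f vy (Less vy vx)) ∧f (bool ⌊ q ≟ qI ⌋ ∧f Carries skip vx)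

  Entered : Fin nQ → Transition → Formula
  Entered q t = bool ⌊ target t ≟ q ⌋ ∧f (StateP (source t) vy ∧f Carries (label t) vx)

  φ-steps φ-ordered φ-decs-matched φ-incs-matched φ-final-last φ-reset φA : Formula
  φ-steps        = ∀f vx (⋀ (allFin nQ) λ q → StateP q vx ⇒f (Initial q ∨f ∃f vy (Succ vy vx ∧f ⋁ δ (Entered q))))
  φ-ordered      = ∀f vx (∀f vy (B vx vy ⇒f (Less vx vy ∧f ⋁ (allFin nC) λ c → Carries (inc c) vx ∧f DecP c vy)))
  φ-decs-matched = ∀f vy (⋀ (allFin nC) λ c → DecP c vy ⇒f ∃count eq 1 vx (B vx vy))
  φ-incs-matched = ∀f vx (∃count le 1 vy (B vx vy))
  φ-final-last   = ∃f vx (¬f (∃f vy (Less vx vy)) ∧f ⋁ (allFin nQ) λ q → bool (final q) ∧f StateP q vx)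
  φ-reset        = ⋀ (allFin nC) λ c → bool (R c) ⇒f ∀f vx (IncP c vx ⇒f ∃f vy (B vx vy))
  φA = φ-steps ∧f (φ-ordered ∧f (φ-decs-matched ∧f (φ-incs-matched ∧f (φ-final-last ∧f φ-reset))))

  module Conditions {n : ℕ} (𝔄 : Structure n) where
    open Structure 𝔄
    open Semantics 𝔄

    StateAt : Fin nQ → Fin n → Set
    StateAt q a = T (Pᴵ ⌜ state (toℕ q) ⌝ a)

    IncAt DecAt : Fin nC → Fin n → Set
    IncAt c a = T (Pᴵ ⌜ incs (toℕ c) ⌝ a)
    DecAt c a = T (Pᴵ ⌜ decs (toℕ c) ⌝ a)

    _≺_ _⋖_ Match : Fin n → Fin n → Set
    a ≺ b     = T (ltᴵ a b)
    a ⋖ b     = T (succᴵ 𝔄 a b)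
    Match a b = T (Bᴵ a b)

    CarriesAt : Op nC → Fin n → Set
    CarriesAt o a = ∀ c → (IncAt c a ⇔ o ≡ inc c) × (DecAt c a ⇔ o ≡ dec c)

    Steps Ordered DecsMatched IncsMatched FinalLast Reset : Set
    Steps       = ∀ a q → StateAt q a →
                    (¬ (∃ λ b → b ≺ a) × q ≡ qI × CarriesAt skip a)
                  ⊎ (∃ λ p → p ⋖ a × ∃ λ t → t ∈ δ × (target t ≡ q × (StateAt (source t) p × CarriesAt (label t) a)))
    Ordered     = ∀ x y → Match x y → x ≺ y × ∃ λ c → CarriesAt (inc c) x × DecAt c y
    DecsMatched = ∀ y c → DecAt c y → ∃ λ x → Match x y × ∀ x′ → Match x′ y → x′ ≡ x
    IncsMatched = ∀ x y y′ → Match x y → Match x y′ → y ≡ y′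
    FinalLast   = ∃ λ a → ¬ (∃ λ b → a ≺ b) × ∃ λ q → T (final q) × StateAt q a
    Reset       = ∀ c → T (R c) → ∀ x → IncAt c x → ∃ λ y → Match x y

    record Holds : Set where
      field
        steps        : Steps
        ordered      : Ordered
        decs-matched : DecsMatched
        incs-matched : IncsMatched
        final-last   : FinalLast
        reset        : Reset

    ⟦Carries⟧ : ∀ {o v ρ} → ⟦ Carries o v ⟧ ρ ⇔ CarriesAt o (ρ v)
    ⟦Carries⟧ = ⇔-trans ⟦⋀Fin⟧ (∀-⇔ λ _ → ⇔-trans ⟦∧⟧
      (⇔-trans ⟦⇔⟧ (⇔-cong ⟦⟧-T (⇔-trans ⟦bool⟧ T-incs?)) ×-⇔ ⇔-trans ⟦⇔⟧ (⇔-cong ⟦⟧-T (⇔-trans ⟦bool⟧ T-decs?))))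

    ⟦Initial⟧ : ∀ {q ρ} → ⟦ Initial q ⟧ ρ ⇔ (¬ (∃ λ b → b ≺ ρ vx) × q ≡ qI × CarriesAt skip (ρ vx))
    ⟦Initial⟧ = ⇔-trans ⟦∧⟧ (⇔-trans ⟦¬⟧ (¬-cong-⇔ (⇔-trans ⟦∃⟧ (∃-⇔ λ _ → ⟦⟧-T)))
                          ×-⇔ ⇔-trans ⟦∧⟧ (⇔-trans ⟦bool⟧ T-⌊⌋ ×-⇔ ⟦Carries⟧))

    ⟦Entered⟧ : ∀ {q t ρ} →
                ⟦ Entered q t ⟧ ρ ⇔ (target t ≡ q × (StateAt (source t) (ρ vy) × CarriesAt (label t) (ρ vx)))
    ⟦Entered⟧ = ⇔-trans ⟦∧⟧ (⇔-trans ⟦bool⟧ T-⌊⌋ ×-⇔ ⇔-trans ⟦∧⟧ (⟦⟧-T ×-⇔ ⟦Carries⟧))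

    ⟦φ-steps⟧ : ∀ {ρ} → ⟦ φ-steps ⟧ ρ ⇔ Steps
    ⟦φ-steps⟧ = ⇔-trans ⟦∀⟧ (∀-⇔ λ _ → ⇔-trans ⟦⋀Fin⟧ (∀-⇔ λ _ → ⇔-trans ⟦⇒⟧ (→-cong-⇔ ⟦⟧-T
      (⇔-trans ⟦∨⟧ (⟦Initial⟧ ⊎-⇔ ⇔-trans ⟦∃⟧ (∃-⇔ λ _ → ⇔-trans ⟦∧⟧
        (⟦⟧-T ×-⇔ ⇔-trans (⟦⋁⟧ δ) (∃-⇔ λ _ → ⇔-id _ ×-⇔ ⟦Entered⟧))))))))

    ⟦φ-ordered⟧ : ∀ {ρ} → ⟦ φ-ordered ⟧ ρ ⇔ Ordered
    ⟦φ-ordered⟧ = ⇔-trans ⟦∀⟧ (∀-⇔ λ _ → ⇔-trans ⟦∀⟧ (∀-⇔ λ _ → ⇔-trans ⟦⇒⟧ (→-cong-⇔ ⟦⟧-T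
      (⇔-trans ⟦∧⟧ (⟦⟧-T ×-⇔ ⇔-trans ⟦⋁Fin⟧ (∃-⇔ λ _ → ⇔-trans ⟦∧⟧ (⟦Carries⟧ ×-⇔ ⟦⟧-T)))))))

    ⟦φ-decs-matched⟧ : ∀ {ρ} → ⟦ φ-decs-matched ⟧ ρ ⇔ DecsMatched
    ⟦φ-decs-matched⟧ = ⇔-trans ⟦∀⟧ (∀-⇔ λ _ → ⇔-trans ⟦⋀Fin⟧ (∀-⇔ λ _ → ⇔-trans ⟦⇒⟧ (→-cong-⇔ ⟦⟧-T
      (⇔-trans ⟦∃=1⟧ (∃-⇔ λ _ → ⟦⟧-T ×-⇔ ∀-⇔ λ _ → →-cong-⇔ ⟦⟧-T (⇔-id _))))))

    ⟦φ-incs-matched⟧ : ∀ {ρ} → ⟦ φ-incs-matched ⟧ ρ ⇔ IncsMatched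
    ⟦φ-incs-matched⟧ = ⇔-trans ⟦∀⟧ (∀-⇔ λ _ → ⇔-trans ⟦∃≤1⟧
      (∀-⇔ λ _ → ∀-⇔ λ _ → →-cong-⇔ ⟦⟧-T (→-cong-⇔ ⟦⟧-T (⇔-id _))))

    ⟦φ-final-last⟧ : ∀ {ρ} → ⟦ φ-final-last ⟧ ρ ⇔ FinalLast
    ⟦φ-final-last⟧ = ⇔-trans ⟦∃⟧ (∃-⇔ λ _ → ⇔-trans ⟦∧⟧
      (⇔-trans ⟦¬⟧ (¬-cong-⇔ (⇔-trans ⟦∃⟧ (∃-⇔ λ _ → ⟦⟧-T)))
       ×-⇔ ⇔-trans ⟦⋁Fin⟧ (∃-⇔ λ _ → ⇔-trans ⟦∧⟧ (⟦bool⟧ ×-⇔ ⟦⟧-T))))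

    ⟦φ-reset⟧ : ∀ {ρ} → ⟦ φ-reset ⟧ ρ ⇔ Reset
    ⟦φ-reset⟧ = ⇔-trans ⟦⋀Fin⟧ (∀-⇔ λ _ → ⇔-trans ⟦⇒⟧ (→-cong-⇔ ⟦bool⟧
      (⇔-trans ⟦∀⟧ (∀-⇔ λ _ → ⇔-trans ⟦⇒⟧ (→-cong-⇔ ⟦⟧-T (⇔-trans ⟦∃⟧ (∃-⇔ λ _ → ⟦⟧-T)))))))

    ⟦φA⟧ : ∀ {ρ} → ⟦ φA ⟧ ρ ⇔ Holds
    ⟦φA⟧ = ⇔-trans ⟦∧⟧ (⇔-trans (⟦φ-steps⟧ ×-⇔ ⇔-trans ⟦∧⟧ (⟦φ-ordered⟧ ×-⇔ ⇔-trans ⟦∧⟧ (⟦φ-decs-matched⟧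
                ×-⇔ ⇔-trans ⟦∧⟧ (⟦φ-incs-matched⟧ ×-⇔ ⇔-trans ⟦∧⟧ (⟦φ-final-last⟧ ×-⇔ ⟦φ-reset⟧)))))
            (mk⇔ (λ (s , m , d , i , f , r) → record { steps = s ; ordered = m ; decs-matched = d
                                                      ; incs-matched = i ; final-last = f ; reset = r })
                 (λ h → let open Holds h in steps , ordered , decs-matched , incs-matched , final-last , reset)))

    ⟦∀∀φA⟧ : ∀ {ρ} → ⟦ ∀f vx (∀f vy φA) ⟧ ρ ⇔ Holds
    ⟦∀∀φA⟧ {ρ} = mk⇔ (λ h → to ⟦φA⟧ (to ⟦∀⟧ (to ⟦∀⟧ h (ρ vx)) (ρ vy)))
                     (λ h → from ⟦∀⟧ λ _ → from ⟦∀⟧ λ _ → from ⟦φA⟧ h)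

update-≗ : ∀ A {v w : Fin (MCA.nC A) → ℕ} c {m} → m ≡ w c → (∀ d → c ≢ d → v d ≡ w d) →
           ∀ d → update A v c m d ≡ w d
update-≗ A c {m} m≡ v≗ d with c ≟ d
... | yes refl = m≡
... | no  c≢d  = v≗ d c≢d

inc-injective : ∀ {k} {c d : Fin k} → inc c ≡ inc d → c ≡ d
inc-injective refl = refl

module Backward (A : MCA) {n : ℕ} (𝔄 : Structure n) where
  open MCA A
  open Structure 𝔄
  open Semantics 𝔄 using (T-succᴵ)
  open Reduction A
  open Conditions 𝔄

  module Order where
    open IsStrictTotalOrder ltᴵ-strictTotal using (compare) renaming (trans to lt-trans; irrefl to lt-irrefl)

    ≺-trans : ∀ {a b c} → a ≺ b → b ≺ c → a ≺ c
    ≺-trans a≺b b≺c = from T-≡ (lt-trans (to T-≡ a≺b) (to T-≡ b≺c))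

    ≺-irrefl : ∀ {a} → ¬ a ≺ a
    ≺-irrefl a≺a = lt-irrefl refl (to T-≡ a≺a)

    ≺-compare : ∀ a b → Tri (a ≺ b) (a ≡ b) (b ≺ a)
    ≺-compare a b with compare a b
    ... | tri< a<b a≢b b≮a = tri< (from T-≡ a<b) a≢b (b≮a ∘ to T-≡)
    ... | tri≈ a≮b a≡b b≮a = tri≈ (a≮b ∘ to T-≡) a≡b (b≮a ∘ to T-≡)
    ... | tri> a≮b a≢b b<a = tri> (a≮b ∘ to T-≡) a≢b (from T-≡ b<a)

  open Order

  _≼_ : Fin n → Fin n → Set
  x ≼ a = x ≺ a ⊎ x ≡ a

  _≼?_ : ∀ x a → Dec (x ≼ a)
  x ≼? a = T? (ltᴵ x a) ⊎-dec (x ≟ a)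

  ⋖⇒≺ : ∀ {p a} → p ⋖ a → p ≺ a
  ⋖⇒≺ = proj₁ ∘ to T-succᴵ

  ⋖-gap : ∀ {p a z} → p ⋖ a → ¬ (p ≺ z × z ≺ a)
  ⋖-gap p⋖a = proj₂ (to T-succᴵ p⋖a) _

  ≼-⋖ : ∀ {p a x} → p ⋖ a → x ≢ a → x ≼ a ⇔ x ≼ p
  ≼-⋖ {p} {a} {x} p⋖a x≢a = mk⇔ below-a below-p
    where
    below-a : x ≼ a → x ≼ p
    below-a (inj₂ x≡a) = ⊥-elim (x≢a x≡a)
    below-a (inj₁ x≺a) with ≺-compare x p
    ... | tri< x≺p _ _ = inj₁ x≺p
    ... | tri≈ _ x≡p _ = inj₂ x≡p
    ... | tri> _ _ p≺x = ⊥-elim (⋖-gap p⋖a (p≺x , x≺a))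
    below-p : x ≼ p → x ≼ a
    below-p (inj₁ x≺p)  = inj₁ (≺-trans x≺p (⋖⇒≺ p⋖a))
    below-p (inj₂ refl) = inj₁ (⋖⇒≺ p⋖a)

  ⋖⇒⋠ : ∀ {p a} → p ⋖ a → ¬ a ≼ p
  ⋖⇒⋠ p⋖a (inj₁ a≺p)  = ≺-irrefl (≺-trans a≺p (⋖⇒≺ p⋖a))
  ⋖⇒⋠ p⋖a (inj₂ refl) = ≺-irrefl (⋖⇒≺ p⋖a)

  Closed : Fin n → Fin n → Set
  Closed a x = ∃ λ y → Match x y × y ≼ a

  -- The increments of c at or before a whose matching decrement comes after a; their number is the
  -- value of counter c at a.
  Open : Fin nC → Fin n → Fin n → Set
  Open c a x = IncAt c x × x ≼ a × ¬ Closed a x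

  Open? : ∀ c a x → Dec (Open c a x)
  Open? c a x = T? _ ×-dec x ≼? a ×-dec ¬? (any? λ y → T? (Bᴵ x y) ×-dec y ≼? a)

  value : Fin n → Fin nC → ℕ
  value a c = count n λ x → ⌊ Open? c a x ⌋

  module _ (holds : Holds) where
    open Holds holds

    Closed-⋖ : ∀ {p a x} → p ⋖ a → ¬ Match x a → Closed a x ⇔ Closed p x
    Closed-⋖ {a = a} {x} p⋖a x↛a = mk⇔
      (λ (y , x→y , y≼a) → y , x→y , to (≼-⋖ p⋖a (y≢a x→y)) y≼a)
      (λ (y , x→y , y≼p) → y , x→y , from (≼-⋖ p⋖a (y≢a x→y)) y≼p)
      where
      y≢a : ∀ {y} → Match x y → y ≢ a
      y≢a x→y refl = x↛a x→y

    Open-⋖ : ∀ {p a x c} → p ⋖ a → x ≢ a → ¬ Match x a → Open c a x ⇔ Open c p x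
    Open-⋖ p⋖a x≢a x↛a = mk⇔
      (λ (i , x≼a , ¬cl) → i , to (≼-⋖ p⋖a x≢a) x≼a , ¬cl ∘ from (Closed-⋖ p⋖a x↛a))
      (λ (i , x≼p , ¬cl) → i , from (≼-⋖ p⋖a x≢a) x≼p , ¬cl ∘ to (Closed-⋖ p⋖a x↛a))

    ¬Open-⋖ : ∀ {p a c} → p ⋖ a → ¬ Open c p a
    ¬Open-⋖ p⋖a (_ , a≼p , _) = ⋖⇒⋠ p⋖a a≼p

    Open-self : ∀ {a c} → Open c a a ⇔ IncAt c a
    Open-self = mk⇔ proj₁ λ i → i , inj₂ refl , λ (y , a→y , y≼a) → ≺-irrefl (≺-≼ (proj₁ (ordered _ _ a→y)) y≼a)
      where
      ≺-≼ : ∀ {a y} → a ≺ y → y ≼ a → a ≺ a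
      ≺-≼ a≺y (inj₁ y≺a)  = ≺-trans a≺y y≺a
      ≺-≼ a≺y (inj₂ refl) = a≺y

    ¬T⌊Open⌋ : ∀ {c a x} → ¬ Open c a x → ¬ T ⌊ Open? c a x ⌋
    ¬T⌊Open⌋ ¬open = ¬open ∘ to T-⌊⌋

    value-unchanged : ∀ {p a d} → p ⋖ a → ¬ IncAt d a → (∀ x → Match x a → ¬ IncAt d x) → value a d ≡ value p d
    value-unchanged {p} {a} {d} p⋖a ¬inc-a ¬inc-matched =
      count-cong-off a (¬T⌊Open⌋ (¬inc-a ∘ to Open-self)) (¬T⌊Open⌋ (¬Open-⋖ p⋖a)) agree
      where
      agree : ∀ x → x ≢ a → ⌊ Open? d a x ⌋ ≡ ⌊ Open? d p x ⌋
      agree x x≢a with T? (Bᴵ x a)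
      ... | yes x→a = ⌊⌋-cong (mk⇔ (⊥-elim ∘ ¬inc-matched x x→a ∘ proj₁) (⊥-elim ∘ ¬inc-matched x x→a ∘ proj₁))
      ... | no  x↛a = ⌊⌋-cong (Open-⋖ p⋖a x≢a x↛a)

    value-inc : ∀ {p a c} → p ⋖ a → IncAt c a → (∀ x → ¬ Match x a) → value a c ≡ suc (value p c)
    value-inc {a = a} p⋖a inc-a unmatched =
      count-insert a (from T-⌊⌋ (from Open-self inc-a)) (¬T⌊Open⌋ (¬Open-⋖ p⋖a))
                   (λ x x≢a → ⌊⌋-cong (Open-⋖ p⋖a x≢a (unmatched x)))

    value-dec : ∀ {p a c x₀} → p ⋖ a → ¬ IncAt c a → Match x₀ a → (∀ x → Match x a → x ≡ x₀) → IncAt c x₀ →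
                value p c ≡ suc (value a c)
    value-dec {p} {a} {c} {x₀} p⋖a ¬inc-a x₀→a unique inc-x₀ =
      count-insert x₀ (from T-⌊⌋ open-p) (¬T⌊Open⌋ λ (_ , _ , ¬closed) → ¬closed (a , x₀→a , inj₂ refl)) agree
      where
      x₀≺a : x₀ ≺ a
      x₀≺a = proj₁ (ordered x₀ a x₀→a)
      x₀≢a : x₀ ≢ a
      x₀≢a refl = ≺-irrefl x₀≺a
      open-p : Open c p x₀
      open-p = inc-x₀ , to (≼-⋖ p⋖a x₀≢a) (inj₁ x₀≺a)
             , λ (y , x₀→y , y≼p) → ⋖⇒⋠ p⋖a (subst (_≼ p) (incs-matched x₀ y a x₀→y x₀→a) y≼p)
      agree : ∀ x → x ≢ x₀ → ⌊ Open? c p x ⌋ ≡ ⌊ Open? c a x ⌋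
      agree x x≢x₀ with x ≟ a
      ... | yes refl = ⌊⌋-cong (mk⇔ (⊥-elim ∘ ¬Open-⋖ p⋖a) (⊥-elim ∘ ¬inc-a ∘ to Open-self))
      ... | no  x≢a  = sym (⌊⌋-cong (Open-⋖ p⋖a x≢a (x≢x₀ ∘ unique x)))

    value-initial : ∀ {a} → ¬ (∃ λ b → b ≺ a) → (∀ c → ¬ IncAt c a) → ∀ c → value a c ≡ 0
    value-initial {a} first ¬inc c = count≡0⇐ {p = λ x → ⌊ Open? c a x ⌋} λ x → ¬pending ∘ to T-⌊⌋
      where
      ¬pending : ∀ {x} → ¬ Open c a x
      ¬pending (_     , inj₁ x≺a  , _) = first (_ , x≺a)
      ¬pending (inc-a , inj₂ refl , _) = ¬inc c inc-a

    value-last : ∀ {a c} → ¬ (∃ λ b → a ≺ b) → T (R c) → value a c ≡ 0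
    value-last {a} {c} last Rc = count≡0⇐ {p = λ x → ⌊ Open? c a x ⌋} λ x → ¬pending ∘ to T-⌊⌋
      where
      ≼a : ∀ y → y ≼ a
      ≼a y with ≺-compare y a
      ... | tri< y≺a _ _ = inj₁ y≺a
      ... | tri≈ _ y≡a _ = inj₂ y≡a
      ... | tri> _ _ a≺y = ⊥-elim (last (y , a≺y))
      ¬pending : ∀ {x} → ¬ Open c a x
      ¬pending {x} (inc-x , _ , ¬closed) = let (y , x→y) = reset c Rc x inc-x in ¬closed (y , x→y , ≼a y)

    rank : Fin n → ℕ
    rank a = count n λ z → ltᴵ z a

    rank-⋖ : ∀ {p a} → p ⋖ a → rank p < rank a
    rank-⋖ {p} {a} p⋖a = count-mono-< {p = λ z → ltᴵ z p} {q = λ z → ltᴵ z a} p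
                            (λ z z≺p → ≺-trans z≺p (⋖⇒≺ p⋖a)) ≺-irrefl (⋖⇒≺ p⋖a)

    unmatched : ∀ {o a} → CarriesAt o a → (∀ c → o ≢ dec c) → ∀ x → ¬ Match x a
    unmatched carries o≢dec x x→a = let (_ , c , _ , dec-a) = ordered x _ x→a in o≢dec c (to (proj₂ (carries c)) dec-a)

    Reaches : Fin n → Fin nQ → Set
    Reaches a q = ∃ λ v → (∀ c → v c ≡ value a c) × Star (Step A) (qI , λ _ → 0) (q , v)

    step : ∀ {p a p₀ o q} → p ⋖ a → (p₀ , o , q) ∈ δ → CarriesAt o a → Reaches p p₀ → Reaches a q
    step {o = skip} p⋖a t∈δ carries (v , v≗ , run) =
      v , (λ c → trans (v≗ c) (sym (value-unchanged p⋖a (λ i → case to (proj₁ (carries c)) i of λ ())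
                                                        (λ x x→a → ⊥-elim (unmatched carries (λ _ ()) x x→a)))))
        , run ◅◅ step-skip t∈δ ◅ ε
    step {a = a} {o = inc c} p⋖a t∈δ carries (v , v≗ , run) =
      update A v c (suc (v c)) , update-≗ A c incremented unchanged , run ◅◅ step-inc t∈δ ◅ ε
      where
      no-match : ∀ x → ¬ Match x a
      no-match = unmatched carries λ _ ()
      incremented : suc (v c) ≡ value a c
      incremented = trans (cong suc (v≗ c)) (sym (value-inc p⋖a (from (proj₁ (carries c)) refl) no-match))
      unchanged : ∀ d → c ≢ d → v d ≡ value a d
      unchanged d c≢d = trans (v≗ d) (sym (value-unchanged p⋖a (λ i → c≢d (inc-injective (to (proj₁ (carries d)) i)))
                                                           (λ x x→a → ⊥-elim (no-match x x→a))))
    step {a = a} {o = dec c} p⋖a t∈δ carries (v , v≗ , run)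
      with decs-matched a c (from (proj₂ (carries c)) refl)
    ... | x₀ , x₀→a , unique with ordered x₀ a x₀→a
    ... | _ , c′ , carries₀ , dec-a with to (proj₂ (carries c′)) dec-a
    ... | refl = update A v c (value a c) , update-≗ A c refl unchanged , run ◅◅ step-dec t∈δ positive ◅ ε
      where
      ¬inc-a : ∀ d → ¬ IncAt d a
      ¬inc-a d i = case to (proj₁ (carries d)) i of λ ()
      positive : v c ≡ suc (value a c)
      positive = trans (v≗ c) (value-dec p⋖a (¬inc-a c) x₀→a unique (from (proj₁ (carries₀ c)) refl))
      unchanged : ∀ d → c ≢ d → v d ≡ value a d
      unchanged d c≢d = trans (v≗ d) (sym (value-unchanged p⋖a (¬inc-a d) λ x x→a inc-x →
        c≢d (inc-injective (to (proj₁ (carries₀ d)) (subst (IncAt d) (unique x x→a) inc-x)))))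

    reachable : ∀ a → Acc (_<_ on rank) a → ∀ q → StateAt q a → Reaches a q
    reachable a (acc rs) q sq with steps a q sq
    ... | inj₁ (first , refl , carries) =
      (λ _ → 0) , (λ c → sym (value-initial first (λ d i → case to (proj₁ (carries d)) i of λ ()) c)) , ε
    ... | inj₂ (p , p⋖a , (p₀ , o , _) , t∈δ , refl , sp , carries) =
      step p⋖a t∈δ carries (reachable p (rs (rank-⋖ p⋖a)) p₀ sp)

    accepting : HasAcceptingRun A
    accepting =
      let (a , last , q , final-q , sq) = final-last
          (v , v≗ , run) = reachable a (On.wellFounded rank <-wellFounded a) q sq
      in q , v , run , to T-≡ final-q , λ c Rc → trans (v≗ c) (value-last last (from T-≡ Rc))

module Forward (A : MCA) where
  open MCA A

  opOf : ∀ {s t} → Step A s t → Op nC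
  opOf (step-inc {c = c} _)   = inc c
  opOf (step-dec {c = c} _ _) = dec c
  opOf (step-skip _)          = skip

  opOf-∈δ : ∀ {p v q w} (st : Step A (p , v) (q , w)) → (p , opOf st , q) ∈ δ
  opOf-∈δ (step-inc t∈δ)   = t∈δ
  opOf-∈δ (step-dec t∈δ _) = t∈δ
  opOf-∈δ (step-skip t∈δ)  = t∈δ

  -- The effect of a step on counter c, with both sides moved so that no subtraction occurs.
  step-balance : ∀ {p v q w} (st : Step A (p , v) (q , w)) c →
                 w c + 𝟙 (decs? (opOf st) (toℕ c)) ≡ v c + 𝟙 (incs? (opOf st) (toℕ c))
  step-balance (step-skip _) c = refl
  step-balance {v = v} (step-inc {c = c₀} _) c with c₀ ≟ c
  ... | yes refl rewrite 𝟙-true (from (T-≡ᵇ {toℕ c}) refl) = sym (+-suc (v c) 0)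
  ... | no  c₀≢c rewrite 𝟙-false (c₀≢c ∘ toℕ-injective ∘ to T-≡ᵇ) = refl
  step-balance {v = v} (step-dec {c = c₀} {m = m} _ vc≡) c with c₀ ≟ c
  ... | yes refl rewrite 𝟙-true (from (T-≡ᵇ {toℕ c}) refl) =
    trans (+-comm m 1) (trans (sym vc≡) (sym (+-identityʳ (v c))))
  ... | no  c₀≢c rewrite 𝟙-false (c₀≢c ∘ toℕ-injective ∘ to T-≡ᵇ) = refl

  length : ∀ {s t} → Star (Step A) s t → ℕ
  length ε        = 0
  length (_ ◅ r) = suc (length r)

  -- Positions 0, …, length r of a run r are its configurations; position i + 1 is entered by the
  -- i-th step, and position 0 by skip.
  stateAt : ∀ {s t} → Star (Step A) s t → ℕ → Fin nQ
  stateAt {p , _} ε        _       = p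
  stateAt {p , _} (_ ◅ r) zero    = p
  stateAt         (_ ◅ r) (suc i) = stateAt r i

  stepOp : ∀ {s t} → Star (Step A) s t → ℕ → Op nC
  stepOp ε         _       = skip
  stepOp (st ◅ r) zero    = opOf st
  stepOp (st ◅ r) (suc i) = stepOp r i

  opAt : ∀ {s t} → Star (Step A) s t → ℕ → Op nC
  opAt r zero    = skip
  opAt r (suc i) = stepOp r i

  incAt? decAt? : ∀ {s t} → Star (Step A) s t → Fin nC → ℕ → Bool
  incAt? r c i = incs? (opAt r i) (toℕ c)
  decAt? r c i = decs? (opAt r i) (toℕ c)

  incsBelow decsBelow : ∀ {s t} → Star (Step A) s t → Fin nC → ℕ → ℕ
  incsBelow r c = countBelow (incAt? r c)
  decsBelow r c = countBelow (decAt? r c)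

  stateAt-zero : ∀ {p v t} (r : Star (Step A) (p , v) t) → stateAt r 0 ≡ p
  stateAt-zero ε       = refl
  stateAt-zero (_ ◅ _) = refl

  stateAt-length : ∀ {s q w} (r : Star (Step A) s (q , w)) → stateAt r (length r) ≡ q
  stateAt-length ε        = refl
  stateAt-length (_ ◅ r) = stateAt-length r

  step-∈δ : ∀ {s t} (r : Star (Step A) s t) i → i < length r → (stateAt r i , opAt r (suc i) , stateAt r (suc i)) ∈ δ
  step-∈δ (st ◅ r) zero    _         = subst (λ q → (_ , opOf st , q) ∈ δ) (sym (stateAt-zero r)) (opOf-∈δ st)
  step-∈δ (st ◅ r) (suc i) (s≤s i<) = step-∈δ r i i<

  step-balance′ : ∀ {p v q w} (st : Step A (p , v) (q , w)) c z →
                  𝟙 (decs? (opOf st) (toℕ c)) + (w c + z) ≡ v c + (𝟙 (incs? (opOf st) (toℕ c)) + z)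
  step-balance′ {v = v} {w = w} st c z =
    begin
      𝟙 d + (w c + z)   ≡⟨ +-exchange (𝟙 d) (w c) z ⟩
      (w c + 𝟙 d) + z   ≡⟨ cong (_+ z) (step-balance st c) ⟩
      (v c + 𝟙 i) + z   ≡⟨ +-assoc (v c) (𝟙 i) z ⟩
      v c + (𝟙 i + z)   ∎
    where
    open ≡-Reasoning
    d = decs? (opOf st) (toℕ c)
    i = incs? (opOf st) (toℕ c)

  balance : ∀ {p v q w} (r : Star (Step A) (p , v) (q , w)) c →
            w c + decsBelow r c (suc (length r)) ≡ v c + incsBelow r c (suc (length r))
  balance ε c = refl
  balance {w = w} (st ◅ r) c =
    begin
      w c + (𝟙 d + decsBelow r c (suc (length r)))   ≡⟨ +-exchange (w c) (𝟙 d) _ ⟩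
      (𝟙 d + w c) + decsBelow r c (suc (length r))   ≡⟨ +-assoc (𝟙 d) (w c) _ ⟩
      𝟙 d + (w c + decsBelow r c (suc (length r)))   ≡⟨ cong (𝟙 d +_) (balance r c) ⟩
      𝟙 d + (_ + incsBelow r c (suc (length r)))     ≡⟨ step-balance′ st c _ ⟩
      _                                               ∎
    where
    open ≡-Reasoning
    d = decs? (opOf st) (toℕ c)

  decs≤incs : ∀ {p v t} (r : Star (Step A) (p , v) t) c i → i ≤ length r →
              decsBelow r c (suc i) ≤ v c + incsBelow r c (suc i)
  decs≤incs r        c zero    _         = z≤n
  decs≤incs (st ◅ r) c (suc i) (s≤s i≤) =
    ≤-trans (+-monoʳ-≤ (𝟙 (decs? (opOf st) (toℕ c))) (decs≤incs r c i i≤)) (≤-reflexive (step-balance′ st c _))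

  module Model {qF nF} (r : Star (Step A) (qI , λ _ → 0) (qF , nF))
               (final-qF : final qF ≡ true) (resets : ∀ c → R c ≡ true → nF c ≡ 0) where
    open Reduction A

    L : ℕ
    L = length r

    I D : Fin nC → ℕ → ℕ
    I = incsBelow r
    D = decsBelow r

    labelled : Fin nQ → Op nC → Unary → Bool
    labelled q o (state k) = toℕ q ≡ᵇ k
    labelled q o (incs k)  = incs? o k
    labelled q o (decs k)  = decs? o k

    -- The k-th increment of a counter is matched with its k-th decrement.
    Matched : ℕ → ℕ → Set
    Matched i j = ∃ λ c → opAt r i ≡ inc c × opAt r j ≡ dec c × I c i ≡ D c j

    matches : Op nC → ℕ → ℕ → Bool
    matches (inc c) i j = decs? (opAt r j) (toℕ c) ∧ (I c i ≡ᵇ D c j)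
    matches (dec c) i j = false
    matches skip    i j = false

    T-matches : ∀ {i j} → T (matches (opAt r i) i j) ⇔ Matched i j
    T-matches {i} with opAt r i
    ... | inc c = mk⇔ (λ t → let (dec-j , I≡D) = to T-∧ t in c , refl , to T-decs? dec-j , to T-≡ᵇ I≡D)
                      (λ { (_ , refl , dec-j , I≡D) → from T-∧ (from T-decs? dec-j , from T-≡ᵇ I≡D) })
    ... | dec c = mk⇔ (λ ()) (λ { (_ , () , _) })
    ... | skip  = mk⇔ (λ ()) (λ { (_ , () , _) })

    𝔄 : Structure (suc L)
    𝔄 = record
      { Pᴵ              = λ i a → labelled (stateAt r (toℕ a)) (opAt r (toℕ a)) (decode i)
      ; Bᴵ              = λ a b → matches (opAt r (toℕ a)) (toℕ a) (toℕ b)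
      ; ltᴵ             = λ a b → toℕ a <ᵇ toℕ b
      ; ltᴵ-strictTotal = IsStrictTotalOrder-⇔ Fin-<-isStrictTotalOrder (⇔-trans (⇔-sym T-<ᵇ) T-≡)
      }

    open Structure 𝔄
    open Semantics 𝔄 using (T-succᴵ)
    open Conditions 𝔄

    T-⌜⌝ : ∀ u a → T (Pᴵ ⌜ u ⌝ a) ⇔ T (labelled (stateAt r (toℕ a)) (opAt r (toℕ a)) u)
    T-⌜⌝ u a = mk⇔ (subst T decoded) (subst T (sym decoded))
      where
      decoded : Pᴵ ⌜ u ⌝ a ≡ labelled (stateAt r (toℕ a)) (opAt r (toℕ a)) u
      decoded = cong (labelled (stateAt r (toℕ a)) (opAt r (toℕ a))) (decode-⌜⌝ u)

    StateAt⇔ : ∀ {q a} → StateAt q a ⇔ stateAt r (toℕ a) ≡ q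
    StateAt⇔ {q} {a} = ⇔-trans (T-⌜⌝ (state (toℕ q)) a) (⇔-trans T-≡ᵇ (mk⇔ toℕ-injective (cong toℕ)))

    carries : ∀ {o a} → opAt r (toℕ a) ≡ o → CarriesAt o a
    carries {a = a} refl c = ⇔-trans (T-⌜⌝ (incs (toℕ c)) a) T-incs? , ⇔-trans (T-⌜⌝ (decs (toℕ c)) a) T-decs?

    IncAt⇒ : ∀ {c a} → IncAt c a → opAt r (toℕ a) ≡ inc c
    IncAt⇒ = to (proj₁ (carries refl _))

    DecAt⇒ : ∀ {c a} → DecAt c a → opAt r (toℕ a) ≡ dec c
    DecAt⇒ = to (proj₂ (carries refl _))

    toℕ≤L : ∀ (a : Fin (suc L)) → toℕ a ≤ L
    toℕ≤L = toℕ≤pred[n]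

    at : ∀ {i} → i < suc L → ∃ λ (a : Fin (suc L)) → toℕ a ≡ i
    at i<N = fromℕ< i<N , toℕ-fromℕ< i<N

    dec-pending : ∀ {c j} → opAt r j ≡ dec c → j ≤ L → D c j < I c j
    dec-pending {c} {j} dec-j j≤L =
      subst₂ _≤_ (countBelow-suc-true (decAt? r c) {j} (from T-decs? dec-j))
                 (countBelow-suc-false (incAt? r c) {j} (λ t → inc≢dec (trans (sym (to T-incs? t)) dec-j)))
                 (decs≤incs r c j j≤L)
      where
      inc≢dec : ∀ {c d} → inc c ≢ dec d
      inc≢dec ()

    inc-pending : ∀ {c i} → T (R c) → opAt r i ≡ inc c → i ≤ L → I c i < D c (suc L)
    inc-pending {c} Rc inc-i i≤L =
      <-≤-trans (countBelow-< (incAt? r c) (from T-incs? inc-i) (s≤s i≤L)) (≤-reflexive (sym drained))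
      where
      drained : D c (suc L) ≡ I c (suc L)
      drained = subst (λ m → m + D c (suc L) ≡ I c (suc L)) (resets c (to T-≡ Rc)) (balance r c)

    ≺⇔< : ∀ {a b} → a ≺ b ⇔ toℕ a < toℕ b
    ≺⇔< {a} {b} = T-<ᵇ {toℕ a} {toℕ b}

    Match⇔ : ∀ {a b} → Match a b ⇔ Matched (toℕ a) (toℕ b)
    Match⇔ {a} {b} = T-matches {toℕ a} {toℕ b}

    steps : Steps
    steps fzero    q sq = inj₁ ((λ ()) , trans (sym (to StateAt⇔ sq)) (stateAt-zero r) , carries refl)
    steps (fsuc b) q sq = inj₂ (inject₁ b , p⋖a , _ , step-∈δ r (toℕ b) (toℕ<n b) , to StateAt⇔ sq
                               , from StateAt⇔ (cong (stateAt r) (toℕ-inject₁ b)) , carries refl)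
      where
      p⋖a : inject₁ b ⋖ fsuc b
      p⋖a = from (T-succᴵ {inject₁ b} {fsuc b}) (from ≺⇔< (s≤s (≤-reflexive (toℕ-inject₁ b))) , λ z (p≺z , z≺a) →
              <⇒≱ (subst (_< toℕ z) (toℕ-inject₁ b) (to (≺⇔< {inject₁ b}) p≺z)) (s≤s⁻¹ (to (≺⇔< {z}) z≺a)))

    ordered : Ordered
    ordered x y x→y =
      let (c , inc-x , dec-y , I≡D) = to (Match⇔ {x} {y}) x→y
      in from ≺⇔< (x<y c inc-x dec-y I≡D) , c , carries inc-x , from (proj₂ (carries dec-y c)) refl
      where
      x<y : ∀ c → opAt r (toℕ x) ≡ inc c → opAt r (toℕ y) ≡ dec c → I c (toℕ x) ≡ D c (toℕ y) → toℕ x < toℕ y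
      x<y c inc-x dec-y I≡D with toℕ x <? toℕ y
      ... | yes x<y = x<y
      ... | no  x≮y = ⊥-elim (<-irrefl refl (<-≤-trans (dec-pending dec-y (toℕ≤L y)) I≤D))
        where
        I≤D : I c (toℕ y) ≤ D c (toℕ y)
        I≤D = subst (I c (toℕ y) ≤_) I≡D (countBelow-mono (incAt? r c) (≮⇒≥ x≮y))

    decs-matched : DecsMatched
    decs-matched y c dec-y with countBelow-find (incAt? r c) (toℕ y) (dec-pending (DecAt⇒ dec-y) (toℕ≤L y))
    ... | i , i<y , inc-i , I≡D with at (<-trans i<y (toℕ<n y))
    ... | x , refl = x , from (Match⇔ {x} {y}) (c , to T-incs? inc-i , DecAt⇒ dec-y , I≡D) , unique
      where
      unique : ∀ x′ → Match x′ y → x′ ≡ x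
      unique x′ x′→y with to (Match⇔ {x′} {y}) x′→y
      ... | c′ , inc-x′ , dec-y′ , I≡D′ with trans (sym (DecAt⇒ {c} {y} dec-y)) dec-y′
      ... | refl = toℕ-injective (countBelow-injective (incAt? r c) (from T-incs? inc-x′) inc-i (trans I≡D′ (sym I≡D)))

    incs-matched : IncsMatched
    incs-matched x y y′ x→y x→y′ with to (Match⇔ {x} {y}) x→y | to (Match⇔ {x} {y′}) x→y′
    ... | c , inc-x , dec-y , I≡D | _ , inc-x′ , dec-y′ , I≡D′ with trans (sym inc-x) inc-x′
    ... | refl = toℕ-injective (countBelow-injective (decAt? r c) (from T-decs? dec-y) (from T-decs? dec-y′)
                                                     (trans (sym I≡D) I≡D′))

    final-last : FinalLast
    final-last with at (n<1+n L)
    ... | a , a≡L = a , (λ (b , a≺b) → <⇒≱ (to (≺⇔< {a} {b}) a≺b) (subst (toℕ b ≤_) (sym a≡L) (toℕ≤L b)))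
                  , qF , from T-≡ final-qF , from StateAt⇔ (trans (cong (stateAt r) a≡L) (stateAt-length r))

    reset : Reset
    reset c Rc x inc-x with countBelow-find (decAt? r c) (suc L) (inc-pending Rc (IncAt⇒ {c} {x} inc-x) (toℕ≤L x))
    ... | j , j<N , dec-j , D≡I with at j<N
    ... | y , refl = y , from (Match⇔ {x} {y}) (c , IncAt⇒ {c} {x} inc-x , to T-decs? dec-j , sym D≡I)

    conditions : Holds
    conditions = record { steps = steps ; ordered = ordered ; decs-matched = decs-matched
                        ; incs-matched = incs-matched ; final-last = final-last ; reset = reset }

reduction-complete : ∀ A → HasAcceptingRun A → FinSat (∀∀ (Reduction.φA A))
reduction-complete A (_ , _ , run , final-qF , resets) =
  L , 𝔄 , (λ _ → fzero) , to T-≡ (to ⟦⟧-T (from ⟦∀∀φA⟧ conditions))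
  where
  open Forward.Model A run final-qF resets
  open Semantics 𝔄
  open Reduction.Conditions A 𝔄

reduction-sound : ∀ A → FinSat (∀∀ (Reduction.φA A)) → HasAcceptingRun A
reduction-sound A (_ , 𝔄 , _ , models) = Backward.accepting A 𝔄 (to ⟦∀∀φA⟧ (from ⟦⟧-T (from T-≡ models)))
  where
  open Semantics 𝔄
  open Reduction.Conditions A 𝔄

corollary5p3 : Σ (MCA → Sentence) λ f →
    (A : MCA) → (HasAcceptingRun A → FinSat (f A)) × (FinSat (f A) → HasAcceptingRun A)
corollary5p3 = (λ A → ∀∀ (Reduction.φA A)) , λ A → reduction-complete A , reduction-sound A
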